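{- Let $a,b\in\mathbb{R}$ and let $n\ge 5$ be an integer. Let $B^{(n)}$ be the $n\times n$ real matrix with entries $$B^{(n)}_{ij} = \begin{cases} 1, & \text{if } -2 \le j-i \le 1,\\ a, & \text{if } (i,j)=(1,n-1) \text{ or } (i,j)=(2,n),\\ b, & \text{if } (i,j)=(1,n),\\ 0, & \text{otherwise},\end{cases}$$ and let $B_n=\det B^{(n)}$. Then $$B_n=\begin{cases} (a-1)^2, & n\equiv 0 \pmod 4,\\ a^2+b+1, & n\equiv 1 \pmod 4,\\ a^2+2a-b, & n\equiv 2 \pmod 4,\\ a^2, & n\equiv 3 \pmod 4.\end{cases}$$
   Context: $B^{(n)}$ is the Toeplitz matrix with ones on the first superdiagonal, main diagonal and first two subdiagonals, the value $a$ on the $(n-2)$-th superdiagonal (positions $(1,n-1)$ and $(2,n)$), the value $b$ in the top-right corner $(1,n)$, and zeros elsewhere. -}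

module Defs where

open import Level using (Level)
open import Data.Nat using (ℕ; zero; suc; _≤ᵇ_)
import Data.Nat as N
open import Data.Fin using (Fin; toℕ; punchIn)
import Data.Fin as F
open import Data.Bool using (Bool; true; false; if_then_else_; _∧_)
open import Data.Nat using (_≡ᵇ_)
open import Algebra.Bundles using (CommutativeRing)

module _ {c ℓ : Level} (R : CommutativeRing c ℓ) where
  open CommutativeRing R

  Matrix : ℕ → Set c
  Matrix n = Fin n → Fin n → Carrier

  ∑ : (n : ℕ) → (Fin n → Carrier) → Carrier
  ∑ zero    f = 0#
  ∑ (suc n) f = f F.zero + ∑ n (λ j → f (F.suc j))

  sgn : ℕ → Carrier
  sgn zero    = 1#
  sgn (suc k) = - sgn k

  det : (n : ℕ) → Matrix n → Carrier
  det zero    M = 1#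
  det (suc n) M =
    ∑ (suc n) (λ j → sgn (toℕ j) * (M F.zero j * det n (λ r s → M (F.suc r) (punchIn j s))))

  -- the matrix B^(n) with parameters a b, written with 0-based indices i j:
  -- paper's (i,j) (1-based) corresponds to (toℕ i + 1, toℕ j + 1).
  --  1 if -2 ≤ j - i ≤ 1, i.e. i ≤ j + 2 and j ≤ i + 1;
  --  a at paper positions (1,n-1) and (2,n), i.e. 0-based (0,n-2), (1,n-1);
  --  b at paper position (1,n), i.e. 0-based (0,n-1);
  --  0 otherwise.
  Bmat : (n : ℕ) → Carrier → Carrier → Matrix n
  Bmat n a b i j =
    if (toℕ i ≤ᵇ N._+_ (toℕ j) 2) ∧ (toℕ j ≤ᵇ N._+_ (toℕ i) 1) then 1#
    else if ((toℕ i ≡ᵇ 0) ∧ (N._+_ (toℕ j) 2 ≡ᵇ n)) then a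
    else if ((toℕ i ≡ᵇ 1) ∧ (N._+_ (toℕ j) 1 ≡ᵇ n)) then a
    else if ((toℕ i ≡ᵇ 0) ∧ (N._+_ (toℕ j) 1 ≡ᵇ n)) then b
    else 0#

module Submission where

-- Deleting the first row of B^(n) leaves rows of a band matrix with bandwidths
-- (1, 2), except for the corner entry a in the new first row.  We therefore study
-- "band submatrices": the matrices formed by chosen columns of the infinite band
-- matrix whose row i has ones exactly in columns i, …, i+3.  A minor of a band
-- submatrix is again one, and a leading unit column can be dropped.  This yields
-- three-term recurrences u(k+3) = u(k+2) - u(k+1) + u(k) for the determinants
--   P m = band matrix,  Q m = band matrix with last column shifted,
--   D₀ m = band matrix with its first column deleted;
-- any such sequence is 4-periodic, and its first values are computed directly.
--
-- Expanding B^(5+k) along its first row (1, 1, 0, …, 0, a, b), and the four minors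
-- along their first rows (which carry the corner a), expresses B_{5+k} as a fixed
-- polynomial in a, b, the sign (-1)^(k+1) and the values D₀(5+k), P(2+k), P(3+k),
-- P(4+k), Q(3+k).  This polynomial is 4-periodic in k, so it suffices to evaluate
-- it at k = 0, 1, 2, 3 using the first values of the sequences.

open import Defs
open import Level using (Level)
open import Data.Nat using (ℕ; zero; suc; _≤_; _<_; _%_; _∸_; _≡ᵇ_; _≤ᵇ_; z≤n; s≤s)
import Data.Nat as N
import Data.Nat.Properties as NP
open import Data.Nat.DivMod using ([m+n]%n≡m%n)
open import Data.Fin using (Fin; toℕ; punchIn; inject₁; fromℕ)
import Data.Fin as F
open import Data.Fin.Properties using (toℕ-fromℕ; toℕ-inject₁; toℕ<n)
open import Data.Bool using (Bool; true; false; T; if_then_else_; _∧_)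
open import Data.Bool.Properties using (¬-not)
open import Data.Product using (_×_; _,_)
open import Relation.Binary.PropositionalEquality as P using (_≡_; _≢_)
open import Algebra.Bundles using (CommutativeRing)

inBand : ℕ → ℕ → Bool
inBand zero zero = true
inBand zero (suc zero) = true
inBand zero (suc (suc zero)) = true
inBand zero (suc (suc (suc zero))) = true
inBand zero (suc (suc (suc (suc _)))) = false
inBand (suc i) zero = false
inBand (suc i) (suc o) = inBand i o

≤ᵇ-suc : ∀ m n → (suc m ≤ᵇ suc n) ≡ (m ≤ᵇ n)
≤ᵇ-suc zero n = P.refl
≤ᵇ-suc (suc m) n = P.refl

Bmat-band : ∀ i t → ((i ≤ᵇ t N.+ 2) ∧ (t ≤ᵇ i N.+ 1)) ≡ inBand i (suc (suc t))
Bmat-band i t rewrite NP.+-comm t 2 | NP.+-comm i 1 = shifted i t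
  where
  shifted : ∀ i t → ((i ≤ᵇ suc (suc t)) ∧ (t ≤ᵇ suc i)) ≡ inBand i (suc (suc t))
  shifted zero zero = P.refl
  shifted zero (suc zero) = P.refl
  shifted zero (suc (suc t)) = P.refl
  shifted (suc zero) zero = P.refl
  shifted (suc (suc zero)) zero = P.refl
  shifted (suc (suc (suc i))) zero = P.refl
  shifted (suc i) (suc t) rewrite ≤ᵇ-suc i (suc (suc t)) | ≤ᵇ-suc t (suc i) = shifted i t

≢⇒≡ᵇ-false : ∀ m n → m ≢ n → (m ≡ᵇ n) ≡ false
≢⇒≡ᵇ-false m n m≢n = ¬-not (λ eq → m≢n (NP.≡ᵇ⇒≡ m n (P.subst T (P.sym eq) _)))

≡⇒≡ᵇ-true : ∀ m n → m ≡ n → (m ≡ᵇ n) ≡ true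
≡⇒≡ᵇ-true zero .zero P.refl = P.refl
≡⇒≡ᵇ-true (suc m) .(suc m) P.refl = ≡⇒≡ᵇ-true m m P.refl

skip : ℕ → ℕ → ℕ
skip zero t = suc t
skip (suc w) zero = zero
skip (suc w) (suc t) = suc (skip w t)

toℕ-punchIn : ∀ {n} (j : Fin (suc n)) (s : Fin n) → toℕ (punchIn j s) ≡ skip (toℕ j) (toℕ s)
toℕ-punchIn F.zero s = P.refl
toℕ-punchIn (F.suc j) F.zero = P.refl
toℕ-punchIn (F.suc j) (F.suc s) = P.cong suc (toℕ-punchIn j s)

skip-below : ∀ w t → t < w → skip w t ≡ t
skip-below (suc w) zero _ = P.refl
skip-below (suc w) (suc t) (s≤s t<w) = P.cong suc (skip-below w t t<w)

skip-above : ∀ w t → w ≤ t → skip w t ≡ suc t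
skip-above zero t _ = P.refl
skip-above (suc w) (suc t) (s≤s w≤t) = P.cong suc (skip-above w t w≤t)

skip≤ : ∀ w t → skip w t ≤ suc t
skip≤ zero t = NP.≤-refl
skip≤ (suc w) zero = z≤n
skip≤ (suc w) (suc t) = s≤s (skip≤ w t)

prependUnit : (ℕ → ℕ) → ℕ → ℕ
prependUnit g zero = zero
prependUnit g (suc t) = suc (g t)

-- The columns of the band matrix with lower bandwidth 1 and upper bandwidth 2
-- (row i has ones in columns i-1, …, i+2), with column w deleted.
gapColumns : ℕ → ℕ → ℕ
gapColumns w t = suc (skip w t)

module _ {c ℓ : Level} (R : CommutativeRing c ℓ) where
  open CommutativeRing R hiding (zero)
  open import Algebra.Properties.Ring ring using (-‿involutive; -1*x≈-x; -‿+-comm; -‿distribʳ-*; -0#≈0#)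
  open import Algebra.Properties.AbelianGroup +-abelianGroup using (xyx⁻¹≈y; ⁻¹-anti-homo‿-)
  open import Algebra.Properties.CommutativeSemigroup +-commutativeSemigroup using (interchange)
  open import Relation.Binary.Reasoning.Setoid setoid

  sub₂ : ∀ {x y x' y'} → x ≈ x' → y ≈ y' → x - y ≈ x' - y'
  sub₂ hx hy = +-cong hx (-‿cong hy)

  sub₃ : ∀ {x y z x' y' z'} → x ≈ x' → y ≈ y' → z ≈ z' → x - y + z ≈ x' - y' + z'
  sub₃ hx hy hz = +-cong (sub₂ hx hy) hz

  x-0≈x : ∀ x → x - 0# ≈ x
  x-0≈x x = trans (+-congˡ -0#≈0#) (+-identityʳ x)

  x-y+y≈x : ∀ x y → x - y + y ≈ x
  x-y+y≈x x y = trans (+-assoc x (- y) y) (trans (+-congˡ (-‿inverseˡ y)) (+-identityʳ x))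

  1-1≈0 : 1# - 1# ≈ 0#
  1-1≈0 = -‿inverseʳ 1#

  0-1+1≈0 : 0# - 1# + 1# ≈ 0#
  0-1+1≈0 = x-y+y≈x 0# 1#

  cofactor-zero : ∀ {s x} d → x ≈ 0# → s * (x * d) ≈ 0#
  cofactor-zero {s} d x≈0 = trans (*-congˡ (trans (*-congʳ x≈0) (zeroˡ d))) (zeroʳ s)

  cofactor-vanishing : ∀ s x {d} → d ≈ 0# → s * (x * d) ≈ 0#
  cofactor-vanishing s x d≈0 = trans (*-congˡ (trans (*-congˡ d≈0) (zeroʳ x))) (zeroʳ s)

  cofactor-one : ∀ {x} d → x ≈ 1# → 1# * (x * d) ≈ d
  cofactor-one d x≈1 = trans (*-identityˡ _) (trans (*-congʳ x≈1) (*-identityˡ d))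

  cofactor-minus-one : ∀ {x} d → x ≈ 1# → - 1# * (x * d) ≈ - d
  cofactor-minus-one d x≈1 = trans (*-congˡ (trans (*-congʳ x≈1) (*-identityˡ d))) (-1*x≈-x d)

  ∑-cong : ∀ n {f g : Fin n → Carrier} → (∀ j → f j ≈ g j) → ∑ R n f ≈ ∑ R n g
  ∑-cong zero eq = refl
  ∑-cong (suc n) eq = +-cong (eq F.zero) (∑-cong n (λ j → eq (F.suc j)))

  ∑-zero : ∀ n {f : Fin n → Carrier} → (∀ j → f j ≈ 0#) → ∑ R n f ≈ 0#
  ∑-zero zero eq = refl
  ∑-zero (suc n) eq = trans (+-cong (eq F.zero) (∑-zero n (λ j → eq (F.suc j)))) (+-identityˡ 0#)

  ∑-+ : ∀ n (f g : Fin n → Carrier) → ∑ R n (λ j → f j + g j) ≈ ∑ R n f + ∑ R n g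
  ∑-+ zero f g = sym (+-identityˡ 0#)
  ∑-+ (suc n) f g = trans (+-congˡ (∑-+ n _ _)) (interchange _ _ _ _)

  ∑-last : ∀ n (f : Fin (suc n) → Carrier) → ∑ R (suc n) f ≈ ∑ R n (λ j → f (inject₁ j)) + f (fromℕ n)
  ∑-last zero f = trans (+-identityʳ _) (sym (+-identityˡ _))
  ∑-last (suc n) f = trans (+-congˡ (∑-last n (λ j → f (F.suc j)))) (sym (+-assoc _ _ _))

  minor : ∀ {n} → Matrix R (suc n) → Fin (suc n) → Matrix R n
  minor M j r s = M (F.suc r) (punchIn j s)

  det-cong : ∀ n {M N : Matrix R n} → (∀ i j → M i j ≈ N i j) → det R n M ≈ det R n N
  det-cong zero eq = refl
  det-cong (suc n) eq =
    ∑-cong (suc n) (λ j → *-congˡ {sgn R (toℕ j)}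
      (*-cong (eq F.zero j) (det-cong n (λ r s → eq (F.suc r) (punchIn j s)))))

  det-1×1 : ∀ (M : Matrix R 1) → det R 1 M ≈ M F.zero F.zero
  det-1×1 M = trans (+-identityʳ _) (trans (*-identityˡ _) (*-identityʳ _))

  det-zero-column : ∀ n (M : Matrix R (suc n)) → (∀ i → M i F.zero ≈ 0#) → det R (suc n) M ≈ 0#
  det-zero-column zero M z = trans (+-identityʳ _) (cofactor-zero _ (z F.zero))
  det-zero-column (suc n) M z =
    trans (+-cong (cofactor-zero _ (z F.zero)) (∑-zero (suc n) later)) (+-identityˡ 0#)
    where
    later : ∀ j → sgn R (suc (toℕ j)) * (M F.zero (F.suc j) * det R (suc n) (minor M (F.suc j))) ≈ 0#
    later j = cofactor-vanishing _ _ (det-zero-column n (minor M (F.suc j)) (λ i → z (F.suc i)))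

  expand-11 : ∀ m (M : Matrix R (2 N.+ m)) → M F.zero F.zero ≈ 1# → M F.zero (F.suc F.zero) ≈ 1# →
    (∀ j → M F.zero (F.suc (F.suc j)) ≈ 0#) →
    det R (2 N.+ m) M ≈ det R (1 N.+ m) (minor M F.zero) - det R (1 N.+ m) (minor M (F.suc F.zero))
  expand-11 m M h₀ h₁ rest =
    trans (+-cong (cofactor-one _ h₀)
                  (+-cong (cofactor-minus-one _ h₁) (∑-zero m (λ j → cofactor-zero _ (rest j)))))
          (+-congˡ (+-identityʳ _))

  expand-111 : ∀ m (M : Matrix R (3 N.+ m)) → M F.zero F.zero ≈ 1# → M F.zero (F.suc F.zero) ≈ 1# →
    M F.zero (F.suc (F.suc F.zero)) ≈ 1# → (∀ j → M F.zero (F.suc (F.suc (F.suc j))) ≈ 0#) →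
    det R (3 N.+ m) M ≈ det R (2 N.+ m) (minor M F.zero) - det R (2 N.+ m) (minor M (F.suc F.zero))
                          + det R (2 N.+ m) (minor M (F.suc (F.suc F.zero)))
  expand-111 m M h₀ h₁ h₂ rest = trans (+-cong (cofactor-one _ h₀) tail) (sym (+-assoc _ _ _))
    where
    two = F.suc (F.suc F.zero)
    third : - (- 1#) * (M F.zero two * det R (2 N.+ m) (minor M two)) ≈ det R (2 N.+ m) (minor M two)
    third = trans (*-congʳ (-‿involutive 1#)) (cofactor-one _ h₂)
    tail : _ ≈ - det R (2 N.+ m) (minor M (F.suc F.zero)) + det R (2 N.+ m) (minor M two)
    tail = +-cong (cofactor-minus-one _ h₁)
                  (trans (+-cong third (∑-zero m (λ j → cofactor-zero _ (rest j)))) (+-identityʳ _))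

  band : ℕ → ℕ → Carrier
  band i o = if inBand i o then 1# else 0#

  Band : (ℕ → ℕ) → (m : ℕ) → Matrix R m
  Band f m i j = band (toℕ i) (f (toℕ j))

  Band-cong : ∀ m f g → (∀ (j : Fin m) → f (toℕ j) ≡ g (toℕ j)) → det R m (Band f m) ≈ det R m (Band g m)
  Band-cong m f g eq = det-cong m (λ i j → reflexive (P.cong (band (toℕ i)) (eq j)))

  -- A minor of a band submatrix is a band submatrix: deleting row 0 lowers all
  -- column indices by one.
  det-minor-Band : ∀ m f g (j : Fin (suc m)) →
    (∀ (s : Fin m) → f (skip (toℕ j) (toℕ s)) ≡ suc (g (toℕ s))) →
    det R m (minor (Band f (suc m)) j) ≈ det R m (Band g m)
  det-minor-Band m f g j eq = det-cong m (λ r s →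
    reflexive (P.cong (band (suc (toℕ r))) (P.trans (P.cong f (toℕ-punchIn j s)) (eq s))))

  det-unitColumn : ∀ m g → det R (suc m) (Band (prependUnit g) (suc m)) ≈ det R m (Band g m)
  det-unitColumn zero g = det-1×1 (Band (prependUnit g) 1)
  det-unitColumn (suc m) g =
    trans (+-cong (cofactor-one _ refl) (∑-zero (suc m) vanishing)) (+-identityʳ _)
    where
    vanishing : ∀ j → sgn R (suc (toℕ j)) * (band 0 (suc (g (toℕ j)))
                  * det R (suc m) (minor (Band (prependUnit g) (suc (suc m))) (F.suc j))) ≈ 0#
    vanishing j = cofactor-vanishing _ _
      (det-zero-column m (minor (Band (prependUnit g) (suc (suc m))) (F.suc j)) (λ i → refl))

  det-unitColumn′ : ∀ m f g → f 0 ≡ 0 → (∀ t → f (suc t) ≡ suc (g t)) →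
    det R (suc m) (Band f (suc m)) ≈ det R m (Band g m)
  det-unitColumn′ m f g f0 fs = trans (Band-cong (suc m) f (prependUnit g) cols) (det-unitColumn m g)
    where
    cols : ∀ (j : Fin (suc m)) → f (toℕ j) ≡ prependUnit g (toℕ j)
    cols F.zero = f0
    cols (F.suc j) = fs (toℕ j)

  Gap : ℕ → (m : ℕ) → Matrix R m
  Gap w = Band (gapColumns w)

  -- Expansion of Gap (3+w) along its first row (1, 1, 1, 0, …): the three minors
  -- are gap matrices after removing up to two leading unit columns.
  Gap-recurrence : ∀ w k → det R (3 N.+ k) (Gap (3 N.+ w) (3 N.+ k))
    ≈ det R (2 N.+ k) (Gap (2 N.+ w) (2 N.+ k)) - det R (1 N.+ k) (Gap (1 N.+ w) (1 N.+ k)) + det R k (Gap w k)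
  Gap-recurrence w k =
    trans (expand-111 k (Gap (3 N.+ w) (3 N.+ k)) refl refl refl (λ _ → refl))
          (+-cong (+-congˡ (-‿cong second)) third)
    where
    cols₁ : ∀ (s : Fin (2 N.+ k)) →
      gapColumns (3 N.+ w) (skip 1 (toℕ s)) ≡ suc (prependUnit (gapColumns (1 N.+ w)) (toℕ s))
    cols₁ F.zero = P.refl
    cols₁ (F.suc s) = P.refl
    second : det R (2 N.+ k) (minor (Gap (3 N.+ w) (3 N.+ k)) (F.suc F.zero)) ≈ det R (1 N.+ k) (Gap (1 N.+ w) (1 N.+ k))
    second = trans (det-minor-Band (2 N.+ k) (gapColumns (3 N.+ w)) (prependUnit (gapColumns (1 N.+ w)))
                                   (F.suc F.zero) cols₁)
                   (det-unitColumn (1 N.+ k) (gapColumns (1 N.+ w)))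
    cols₂ : ∀ (s : Fin (2 N.+ k)) →
      gapColumns (3 N.+ w) (skip 2 (toℕ s)) ≡ suc (prependUnit (prependUnit (gapColumns w)) (toℕ s))
    cols₂ F.zero = P.refl
    cols₂ (F.suc F.zero) = P.refl
    cols₂ (F.suc (F.suc s)) = P.refl
    third : det R (2 N.+ k) (minor (Gap (3 N.+ w) (3 N.+ k)) (F.suc (F.suc F.zero))) ≈ det R k (Gap w k)
    third = trans (det-minor-Band (2 N.+ k) (gapColumns (3 N.+ w)) (prependUnit (prependUnit (gapColumns w)))
                                  (F.suc (F.suc F.zero)) cols₂)
                  (trans (det-unitColumn (1 N.+ k) (prependUnit (gapColumns w))) (det-unitColumn k (gapColumns w)))

  -- The same expansion for the columns w = 0, 1, 2, where the first row is (1, 1, 0, …).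
  Gap₀-recurrence : ∀ k → det R (2 N.+ k) (Gap 0 (2 N.+ k))
    ≈ det R (1 N.+ k) (Gap 0 (1 N.+ k)) - det R (1 N.+ k) (Gap 1 (1 N.+ k))
  Gap₀-recurrence k = trans (expand-11 k (Gap 0 (2 N.+ k)) refl refl (λ _ → refl)) (+-congˡ (-‿cong second))
    where
    cols : ∀ (s : Fin (1 N.+ k)) → gapColumns 0 (skip 1 (toℕ s)) ≡ suc (gapColumns 1 (toℕ s))
    cols F.zero = P.refl
    cols (F.suc s) = P.refl
    second : det R (1 N.+ k) (minor (Gap 0 (2 N.+ k)) (F.suc F.zero)) ≈ det R (1 N.+ k) (Gap 1 (1 N.+ k))
    second = det-minor-Band (1 N.+ k) (gapColumns 0) (gapColumns 1) (F.suc F.zero) cols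

  Gap₁-recurrence : ∀ k → det R (2 N.+ k) (Gap 1 (2 N.+ k)) ≈ det R (1 N.+ k) (Gap 0 (1 N.+ k)) - det R k (Gap 0 k)
  Gap₁-recurrence k = trans (expand-11 k (Gap 1 (2 N.+ k)) refl refl (λ _ → refl)) (+-congˡ (-‿cong second))
    where
    cols : ∀ (s : Fin (1 N.+ k)) → gapColumns 1 (skip 1 (toℕ s)) ≡ suc (prependUnit (gapColumns 0) (toℕ s))
    cols F.zero = P.refl
    cols (F.suc s) = P.refl
    second : det R (1 N.+ k) (minor (Gap 1 (2 N.+ k)) (F.suc F.zero)) ≈ det R k (Gap 0 k)
    second = trans (det-minor-Band (1 N.+ k) (gapColumns 1) (prependUnit (gapColumns 0)) (F.suc F.zero) cols)
                   (det-unitColumn k (gapColumns 0))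

  Gap₂-recurrence : ∀ k → det R (2 N.+ k) (Gap 2 (2 N.+ k)) ≈ det R (1 N.+ k) (Gap 1 (1 N.+ k)) - det R k (Gap 0 k)
  Gap₂-recurrence k = trans (expand-11 k (Gap 2 (2 N.+ k)) refl refl (λ _ → refl)) (+-congˡ (-‿cong second))
    where
    cols : ∀ (s : Fin (1 N.+ k)) → gapColumns 2 (skip 1 (toℕ s)) ≡ suc (prependUnit (gapColumns 0) (toℕ s))
    cols F.zero = P.refl
    cols (F.suc s) = P.refl
    second : det R (1 N.+ k) (minor (Gap 2 (2 N.+ k)) (F.suc F.zero)) ≈ det R k (Gap 0 k)
    second = trans (det-minor-Band (1 N.+ k) (gapColumns 2) (prependUnit (gapColumns 0)) (F.suc F.zero) cols)
                   (det-unitColumn k (gapColumns 0))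

  -- Sequences satisfying u(k+3) = u(k+2) - u(k+1) + u(k); the characteristic
  -- polynomial is (x - 1)(x² + 1), so they have period four.
  Recurrent : (ℕ → Carrier) → Set ℓ
  Recurrent u = ∀ k → u (3 N.+ k) ≈ u (2 N.+ k) - u (1 N.+ k) + u k

  period-four : ∀ u → Recurrent u → ∀ k → u (4 N.+ k) ≈ u k
  period-four u rec k = begin
    u (4 N.+ k)                                             ≈⟨ rec (1 N.+ k) ⟩
    u (3 N.+ k) - u (2 N.+ k) + u (1 N.+ k)                 ≈⟨ +-congʳ (+-congʳ (rec k)) ⟩
    u (2 N.+ k) - u (1 N.+ k) + u k - u (2 N.+ k) + u (1 N.+ k) ≈⟨ cancel (u (2 N.+ k)) (u (1 N.+ k)) (u k) ⟩
    u k                                                     ∎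
    where
    cancel : ∀ x y z → x - y + z - x + y ≈ z
    cancel x y z = begin
      x - y + z - x + y       ≈⟨ +-congʳ (+-congʳ (+-assoc x (- y) z)) ⟩
      x + (- y + z) - x + y   ≈⟨ +-congʳ (xyx⁻¹≈y x (- y + z)) ⟩
      - y + z + y             ≈⟨ +-congʳ (+-comm (- y) z) ⟩
      z - y + y               ≈⟨ x-y+y≈x z y ⟩
      z                       ∎

  -- Rows 1, 2, … of B^(n) with corner entry x: the band shifted by one column,
  -- plus x in the last column (column n-1) of the first of these rows.
  corner : Carrier → ℕ → ℕ → Carrier
  corner x n c = if (c N.+ 1 ≡ᵇ n) then x else 0#

  lowerEntry : Carrier → ℕ → ℕ → ℕ → Carrier
  lowerEntry x n zero c = band 0 (suc c) + corner x n c
  lowerEntry x n (suc r) c = band (suc r) (suc c)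

  -- The minor of B^(n) at column w.
  Lower : Carrier → ℕ → ℕ → (m : ℕ) → Matrix R m
  Lower x n w m i j = lowerEntry x n (toℕ i) (skip w (toℕ j))

  corner-below : ∀ x n c → suc c < n → corner x n c ≈ 0#
  corner-below x n c c<n rewrite ≢⇒≡ᵇ-false (c N.+ 1) n (NP.<⇒≢ (P.subst (_< n) (NP.+-comm 1 c) c<n)) = refl

  corner-at : ∀ x n c → c N.+ 1 ≡ n → corner x n c ≈ x
  corner-at x n c eq rewrite ≡⇒≡ᵇ-true (c N.+ 1) n eq = refl

  split-cofactor : ∀ s u v d → s * ((u + v) * d) ≈ s * (u * d) + s * (v * d)
  split-cofactor s u v d = trans (*-congˡ (distribʳ d u v)) (distribˡ s _ _)

  -- Expanding a minor along its first row: the band part of the row gives a gap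
  -- matrix, the corner (in the last column, beyond the deleted column w) a band
  -- submatrix.
  det-Lower : ∀ x M w → w ≤ M → det R (suc M) (Lower x (2 N.+ M) w (suc M))
    ≈ det R (suc M) (Gap w (suc M)) + sgn R M * (x * det R M (Band (skip w) M))
  det-Lower x M w w≤M = begin
    det R (suc M) (Lower x (2 N.+ M) w (suc M))
      ≈⟨ ∑-cong (suc M) (λ j → split-cofactor (sgn R (toℕ j)) (band 0 (gapColumns w (toℕ j)))
                                               (corner x (2 N.+ M) (skip w (toℕ j))) (cofactor j)) ⟩
    ∑ R (suc M) (λ j → bandTerm j + cornerTerm j)
      ≈⟨ ∑-+ (suc M) bandTerm cornerTerm ⟩
    det R (suc M) (Gap w (suc M)) + ∑ R (suc M) cornerTerm
      ≈⟨ +-congˡ (trans (∑-last M cornerTerm) (trans (+-cong (∑-zero M before) last) (+-identityˡ _))) ⟩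
    det R (suc M) (Gap w (suc M)) + sgn R M * (x * det R M (Band (skip w) M)) ∎
    where
    cofactor : Fin (suc M) → Carrier
    cofactor j = det R M (minor (Gap w (suc M)) j)
    bandTerm cornerTerm : Fin (suc M) → Carrier
    bandTerm j = sgn R (toℕ j) * (band 0 (gapColumns w (toℕ j)) * cofactor j)
    cornerTerm j = sgn R (toℕ j) * (corner x (2 N.+ M) (skip w (toℕ j)) * cofactor j)
    before : ∀ j → cornerTerm (inject₁ j) ≈ 0#
    before j = cofactor-zero (cofactor (inject₁ j)) (corner-below x (2 N.+ M) _ (s≤s (s≤s skip≤M)))
      where
      skip≤M : skip w (toℕ (inject₁ j)) ≤ M
      skip≤M = NP.≤-trans (skip≤ w _) (P.subst (λ v → suc v ≤ M) (P.sym (toℕ-inject₁ j)) (toℕ<n j))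
    skip-last : skip w (toℕ (fromℕ M)) ≡ suc M
    skip-last = P.trans (P.cong (skip w) (toℕ-fromℕ M)) (skip-above w M w≤M)
    last-minor : cofactor (fromℕ M) ≈ det R M (Band (skip w) M)
    last-minor = det-minor-Band M (gapColumns w) (skip w) (fromℕ M) (λ s →
      P.cong (gapColumns w) (P.trans (P.cong (λ v → skip v (toℕ s)) (toℕ-fromℕ M)) (skip-below M (toℕ s) (toℕ<n s))))
    last : cornerTerm (fromℕ M) ≈ sgn R M * (x * det R M (Band (skip w) M))
    last = *-cong (reflexive (P.cong (sgn R) (toℕ-fromℕ M)))
                  (*-cong (corner-at x _ _ (P.trans (NP.+-comm _ 1) (P.cong suc skip-last))) last-minor)

  -- Deleting column w+1 keeps column 0 as a leading unit column.
  det-Band-skip-suc : ∀ m w → det R (suc m) (Band (skip (suc w)) (suc m)) ≈ det R m (Band (skip w) m)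
  det-Band-skip-suc m w = det-unitColumn′ m (skip (suc w)) (skip w) P.refl (λ t → P.refl)

  -- The band submatrix on the columns 0, …, m-1 is upper unitriangular.
  det-Band-id : ∀ m → det R m (Band (λ t → t) m) ≈ 1#
  det-Band-id zero = refl
  det-Band-id (suc m) = trans (det-unitColumn′ m (λ t → t) (λ t → t) P.refl (λ t → P.refl)) (det-Band-id m)

  det-Band-skip-beyond : ∀ m w → m ≤ w → det R m (Band (skip w) m) ≈ 1#
  det-Band-skip-beyond m w m≤w =
    trans (Band-cong m (skip w) (λ t → t) (λ j → skip-below w (toℕ j) (NP.≤-trans (toℕ<n j) m≤w))) (det-Band-id m)

  Gap-1×1 : ∀ w → det R 1 (Gap w 1) ≈ 1#
  Gap-1×1 zero = det-1×1 (Gap 0 1)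
  Gap-1×1 (suc w) = det-1×1 (Gap (suc w) 1)

  -- They are opaque, so that
  -- instances at concrete indices are compared by their index and never by
  -- unfolding the (exponentially large) Laplace expansion.
  opaque
    P Q D₀ : ℕ → Carrier
    P m = det R m (Gap m m)
    Q m = det R (suc m) (Gap m (suc m))
    D₀ m = det R m (Gap 0 m)

    P-recurrent : Recurrent P
    P-recurrent k = Gap-recurrence k k

    Q-recurrent : Recurrent Q
    Q-recurrent k = Gap-recurrence k (suc k)

    -- Gap 1 is eliminated: D₀(k+3) = D₀(k+2) - D₁(k+2) and D₁(k+2) = D₀(k+1) - D₀(k).
    D₀-recurrent : Recurrent D₀
    D₀-recurrent k = trans (Gap₀-recurrence (1 N.+ k))
                           (trans (+-congˡ (-‿cong (Gap₁-recurrence k))) (x-[y-z]≈x-y+z _ _ _))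
      where
      x-[y-z]≈x-y+z : ∀ x y z → x - (y - z) ≈ x - y + z
      x-[y-z]≈x-y+z x y z = begin
        x + - (y + - z)   ≈⟨ +-congˡ (sym (-‿+-comm y (- z))) ⟩
        x + (- y + - - z) ≈⟨ +-congˡ (+-congˡ (-‿involutive z)) ⟩
        x + (- y + z)     ≈⟨ sym (+-assoc x (- y) z) ⟩
        x - y + z         ∎

    P₀ : P 0 ≈ 1#
    P₀ = refl

    P₁ : P 1 ≈ 1#
    P₁ = Gap-1×1 1

    P₂ : P 2 ≈ 0#
    P₂ = trans (Gap₂-recurrence 0) (trans (sub₂ (Gap-1×1 1) refl) 1-1≈0)

    P₃ : P 3 ≈ 0#
    P₃ = trans (P-recurrent 0) (trans (sub₃ P₂ (Gap-1×1 1) refl) 0-1+1≈0)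

    Q₀ : Q 0 ≈ 1#
    Q₀ = Gap-1×1 0

    Q₁ : Q 1 ≈ 0#
    Q₁ = trans (Gap₁-recurrence 0) (trans (sub₂ (Gap-1×1 0) refl) 1-1≈0)

    Q₂ : Q 2 ≈ - 1#
    Q₂ = trans (Gap₂-recurrence 1) (trans (sub₂ Q₁ (Gap-1×1 0)) (+-identityˡ _))

    Q₃ : Q 3 ≈ 0#
    Q₃ = trans (Q-recurrent 0) (trans (sub₃ Q₂ Q₁ (Gap-1×1 0)) -1-0+1≈0)
      where
      -1-0+1≈0 : - 1# - 0# + 1# ≈ 0#
      -1-0+1≈0 = trans (+-congʳ (trans (+-congˡ -0#≈0#) (+-identityʳ _))) (-‿inverseˡ 1#)

    D₀₀ : D₀ 0 ≈ 1#
    D₀₀ = refl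

    D₀₁ : D₀ 1 ≈ 1#
    D₀₁ = Gap-1×1 0

    D₀₂ : D₀ 2 ≈ 0#
    D₀₂ = trans (Gap₀-recurrence 0) (trans (sub₂ (Gap-1×1 0) (Gap-1×1 1)) 1-1≈0)

    D₀₃ : D₀ 3 ≈ 0#
    D₀₃ = trans (D₀-recurrent 0) (trans (sub₃ D₀₂ D₀₁ refl) 0-1+1≈0)

    Q-as-Gap : ∀ m → det R (suc m) (Gap m (suc m)) ≈ Q m
    Q-as-Gap m = refl

    D₀-as-Gaps : ∀ m → det R (suc m) (Gap 0 (suc m)) - det R (suc m) (Gap 1 (suc m)) ≈ D₀ (suc (suc m))
    D₀-as-Gaps m = sym (Gap₀-recurrence m)

    P-as-Band : ∀ m → det R m (Band (skip 0) m) ≈ P m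
    P-as-Band m = Band-cong m (skip 0) (gapColumns m) (λ j → P.cong suc (P.sym (skip-below m (toℕ j) (toℕ<n j))))

    -- The minor of B at its last column: the corner lies in the deleted column.
    P-as-Lower : ∀ x M → det R M (Lower x (suc M) M M) ≈ P M
    P-as-Lower x M = det-cong M entries
      where
      entries : ∀ i j → Lower x (suc M) M M i j ≈ Gap M M i j
      entries F.zero j = trans (+-congˡ (corner-below x (suc M) _ (s≤s skip<M))) (+-identityʳ _)
        where
        skip<M : skip M (toℕ j) < M
        skip<M = P.subst (_< M) (P.sym (skip-below M (toℕ j) (toℕ<n j))) (toℕ<n j)
      entries (F.suc i) j = refl

  P-period : ∀ k → P (4 N.+ k) ≈ P k
  P-period = period-four P P-recurrent

  Q-period : ∀ k → Q (4 N.+ k) ≈ Q k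
  Q-period = period-four Q Q-recurrent

  D₀-period : ∀ k → D₀ (4 N.+ k) ≈ D₀ k
  D₀-period = period-four D₀ D₀-recurrent

  if-true : ∀ {β} (x y : Carrier) → β ≡ true → (if β then x else y) ≡ x
  if-true x y P.refl = P.refl

  if-false : ∀ {β} (x y : Carrier) → β ≡ false → (if β then x else y) ≡ y
  if-false x y P.refl = P.refl

  -- The value of the first-row expansion of B^(5+k) in terms of the sequences,
  -- with s = (-1)^(k+1); see B-formula.
  expansionValue : (a b y p₂ p₃ p₄ q s : Carrier) → Carrier
  expansionValue a b y p₂ p₃ p₄ q s = y + s * (a * p₃) - s * (a * p₂) + (s * (a * (q + s * a)) + - s * (b * p₄))

  expansionValue-cong : ∀ a b {y p₂ p₃ p₄ q s y′ p₂′ p₃′ p₄′ q′ s′} →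
    y ≈ y′ → p₂ ≈ p₂′ → p₃ ≈ p₃′ → p₄ ≈ p₄′ → q ≈ q′ → s ≈ s′ →
    expansionValue a b y p₂ p₃ p₄ q s ≈ expansionValue a b y′ p₂′ p₃′ p₄′ q′ s′
  expansionValue-cong a b hy h₂ h₃ h₄ hq hs =
    +-cong (sub₂ (+-cong hy (*-cong hs (*-congˡ h₃))) (*-cong hs (*-congˡ h₂)))
           (+-cong (*-cong hs (*-congˡ (+-cong hq (*-congʳ hs)))) (*-cong (-‿cong hs) (*-congˡ h₄)))

  expansionAt : Carrier → Carrier → ℕ → Carrier
  expansionAt a b k =
    expansionValue a b (D₀ (5 N.+ k)) (P (2 N.+ k)) (P (3 N.+ k)) (P (4 N.+ k)) (Q (3 N.+ k)) (sgn R (3 N.+ k))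

  module Expansion (a b : Carrier) (k : ℕ) where
    -- The first row (1, 1, 0, …, 0, a, b) of B^(5+k) as a function of the column;
    -- Bmat R (5+k) a b F.zero j reduces to firstRow (toℕ j).
    firstRow : ℕ → Carrier
    firstRow c = if (c ≤ᵇ 1) then 1#
                 else if (c N.+ 2 ≡ᵇ 5 N.+ k) then a
                 else if (c N.+ 1 ≡ᵇ 5 N.+ k) then b
                 else 0#

    firstRow-middle : ∀ t → t ≤ k → firstRow (2 N.+ t) ≈ 0#
    firstRow-middle t t≤k = reflexive (P.trans (if-false a _ (≢⇒≡ᵇ-false _ (5 N.+ k) (NP.<⇒≢ lt₂)))
                                               (if-false b 0# (≢⇒≡ᵇ-false _ (5 N.+ k) (NP.<⇒≢ lt₁))))
      where
      lt₂ : 2 N.+ t N.+ 2 < (5 N.+ k)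
      lt₂ = P.subst (_< (5 N.+ k)) (NP.+-comm 2 (2 N.+ t)) (s≤s (s≤s (s≤s (s≤s (s≤s t≤k)))))
      lt₁ : 2 N.+ t N.+ 1 < (5 N.+ k)
      lt₁ = P.subst (_< (5 N.+ k)) (NP.+-comm 1 (2 N.+ t)) (s≤s (s≤s (s≤s (s≤s (NP.m≤n⇒m≤1+n t≤k)))))

    firstRow-a : firstRow (3 N.+ k) ≈ a
    firstRow-a = reflexive (if-true a _ (≡⇒≡ᵇ-true _ (5 N.+ k) (NP.+-comm (3 N.+ k) 2)))

    firstRow-b : firstRow (4 N.+ k) ≈ b
    firstRow-b = reflexive (P.trans (if-false a _ (≢⇒≡ᵇ-false _ (5 N.+ k) (NP.>⇒≢ gt)))
                                    (if-true b 0# (≡⇒≡ᵇ-true _ (5 N.+ k) (NP.+-comm (4 N.+ k) 1))))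
      where
      gt : (5 N.+ k) < 4 N.+ k N.+ 2
      gt = P.subst ((5 N.+ k) <_) (NP.+-comm 2 (4 N.+ k)) NP.≤-refl

    Bmat-lower : ∀ (r : Fin (4 N.+ k)) (j : Fin (5 N.+ k)) →
      Bmat R (5 N.+ k) a b (F.suc r) j ≈ lowerEntry a (5 N.+ k) (toℕ r) (toℕ j)
    Bmat-lower r j = entry (toℕ r) (toℕ j) _ (Bmat-band (suc (toℕ r)) (toℕ j))
      where
      entry : ∀ r t β → β ≡ inBand r (suc t) →
              (if β then 1# else (if ((r ≡ᵇ 0) ∧ (t N.+ 1 ≡ᵇ 5 N.+ k)) then a else 0#))
                ≈ lowerEntry a (5 N.+ k) r t
      entry zero zero β P.refl = sym (+-identityʳ 1#)
      entry zero (suc zero) β P.refl = sym (+-identityʳ 1#)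
      entry zero (suc (suc zero)) β P.refl = sym (+-identityʳ 1#)
      entry zero (suc (suc (suc t))) β P.refl = sym (+-identityˡ _)
      entry (suc r) t β P.refl = refl

    X : ℕ → Carrier
    X w = det R (4 N.+ k) (Lower a (5 N.+ k) w (4 N.+ k))

    Bmat-minor : ∀ (j : Fin (5 N.+ k)) w → toℕ j ≡ w → det R (4 N.+ k) (minor (Bmat R (5 N.+ k) a b) j) ≈ X w
    Bmat-minor j w eq = det-cong (4 N.+ k) (λ r s → trans (Bmat-lower r (punchIn j s))
      (reflexive (P.cong (lowerEntry a (5 N.+ k) (toℕ r))
                         (P.trans (toℕ-punchIn j s) (P.cong (λ v → skip v (toℕ s)) eq)))))

    Bmat-expansion : det R (5 N.+ k) (Bmat R (5 N.+ k) a b)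
      ≈ X 0 - X 1 + (sgn R (3 N.+ k) * (a * X (3 N.+ k)) + sgn R (4 N.+ k) * (b * X (4 N.+ k)))
    Bmat-expansion = trans (+-cong first (+-cong second later)) (sym (+-assoc _ _ _))
      where
      term : Fin (3 N.+ k) → Carrier
      term j = sgn R (2 N.+ toℕ j)
               * (firstRow (2 N.+ toℕ j) * det R (4 N.+ k) (minor (Bmat R (5 N.+ k) a b) (F.suc (F.suc j))))
      first : 1# * (1# * det R (4 N.+ k) (minor (Bmat R (5 N.+ k) a b) F.zero)) ≈ X 0
      first = trans (cofactor-one _ refl) (Bmat-minor F.zero 0 P.refl)
      second : - 1# * (1# * det R (4 N.+ k) (minor (Bmat R (5 N.+ k) a b) (F.suc F.zero))) ≈ - X 1
      second = trans (cofactor-minus-one _ refl) (-‿cong (Bmat-minor _ 1 P.refl))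
      middle : ∀ j → term (inject₁ (inject₁ j)) ≈ 0#
      middle j = cofactor-zero _ (firstRow-middle _ t≤k)
        where
        t≤k : toℕ (inject₁ (inject₁ j)) ≤ k
        t≤k = P.subst (_≤ k) (P.sym (P.trans (toℕ-inject₁ _) (toℕ-inject₁ j))) (N.s≤s⁻¹ (toℕ<n j))
      index-a : 2 N.+ toℕ (inject₁ (fromℕ (1 N.+ k))) ≡ 3 N.+ k
      index-a = P.cong (2 N.+_) (P.trans (toℕ-inject₁ (fromℕ (1 N.+ k))) (toℕ-fromℕ (1 N.+ k)))
      index-b : 2 N.+ toℕ (fromℕ (2 N.+ k)) ≡ 4 N.+ k
      index-b = P.cong (2 N.+_) (toℕ-fromℕ (2 N.+ k))
      term-a : term (inject₁ (fromℕ (1 N.+ k))) ≈ sgn R (3 N.+ k) * (a * X (3 N.+ k))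
      term-a = *-cong (reflexive (P.cong (sgn R) index-a))
                      (*-cong (trans (reflexive (P.cong firstRow index-a)) firstRow-a) (Bmat-minor _ _ index-a))
      term-b : term (fromℕ (2 N.+ k)) ≈ sgn R (4 N.+ k) * (b * X (4 N.+ k))
      term-b = *-cong (reflexive (P.cong (sgn R) index-b))
                      (*-cong (trans (reflexive (P.cong firstRow index-b)) firstRow-b) (Bmat-minor _ _ index-b))
      later : ∑ R (3 N.+ k) term ≈ sgn R (3 N.+ k) * (a * X (3 N.+ k)) + sgn R (4 N.+ k) * (b * X (4 N.+ k))
      later = trans (∑-last (2 N.+ k) term)
                (+-cong (trans (∑-last (1 N.+ k) (λ j → term (inject₁ j)))
                               (trans (+-cong (∑-zero (1 N.+ k) middle) term-a) (+-identityˡ _)))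
                        term-b)

    -- Identifying the four minors, with s = (-1)^(k+1):
    --   X 0 = det Gap₀ + s a P(3+k),   X 1 = det Gap₁ + s a P(2+k),
    --   X (3+k) = Q(3+k) + s a,        X (4+k) = P(4+k),
    -- where det Gap₀ - det Gap₁ = D₀(5+k).
    B-formula : det R (5 N.+ k) (Bmat R (5 N.+ k) a b) ≈ expansionAt a b k
    B-formula = begin
      det R (5 N.+ k) (Bmat R (5 N.+ k) a b)
        ≈⟨ Bmat-expansion ⟩
      X 0 - X 1 + (s * (a * X (3 N.+ k)) + - s * (b * X (4 N.+ k)))
        ≈⟨ +-cong (sub₂ X₀ X₁) (+-cong (*-congˡ (*-congˡ X-a)) (*-congˡ (*-congˡ (P-as-Lower a (4 N.+ k))))) ⟩
      (D₀′ + s * (a * P (3 N.+ k))) - (D₁′ + s * (a * P (2 N.+ k))) + r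
        ≈⟨ +-congʳ (regroup _ _ _ _) ⟩
      D₀′ - D₁′ + s * (a * P (3 N.+ k)) - s * (a * P (2 N.+ k)) + r
        ≈⟨ +-congʳ (+-congʳ (+-congʳ (D₀-as-Gaps (3 N.+ k)))) ⟩
      expansionAt a b k ∎
      where
      s = sgn R (3 N.+ k)
      D₀′ = det R (suc (3 N.+ k)) (Gap 0 (suc (3 N.+ k)))
      D₁′ = det R (suc (3 N.+ k)) (Gap 1 (suc (3 N.+ k)))
      r = s * (a * (Q (3 N.+ k) + s * a)) + - s * (b * P (4 N.+ k))
      X₀ : X 0 ≈ D₀′ + s * (a * P (3 N.+ k))
      X₀ = trans (det-Lower a (3 N.+ k) 0 z≤n) (+-congˡ (*-congˡ (*-congˡ (P-as-Band (3 N.+ k)))))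
      X₁ : X 1 ≈ D₁′ + s * (a * P (2 N.+ k))
      X₁ = trans (det-Lower a (3 N.+ k) 1 (s≤s z≤n))
                 (+-congˡ (*-congˡ (*-congˡ (trans (det-Band-skip-suc (2 N.+ k) 0) (P-as-Band (2 N.+ k))))))
      X-a : X (3 N.+ k) ≈ Q (3 N.+ k) + s * a
      X-a = trans (det-Lower a (3 N.+ k) (3 N.+ k) NP.≤-refl)
                  (+-cong (Q-as-Gap (3 N.+ k))
                          (*-congˡ (trans (*-congˡ (det-Band-skip-beyond (3 N.+ k) (3 N.+ k) NP.≤-refl)) (*-identityʳ a))))
      regroup : ∀ x₀ t₃ x₁ t₂ → x₀ + t₃ - (x₁ + t₂) ≈ x₀ - x₁ + t₃ - t₂
      regroup x₀ t₃ x₁ t₂ = begin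
        x₀ + t₃ + - (x₁ + t₂)     ≈⟨ +-congˡ (sym (-‿+-comm x₁ t₂)) ⟩
        x₀ + t₃ + (- x₁ + - t₂)   ≈⟨ interchange x₀ t₃ (- x₁) (- t₂) ⟩
        x₀ + - x₁ + (t₃ + - t₂)   ≈⟨ sym (+-assoc _ _ _) ⟩
        x₀ - x₁ + t₃ - t₂         ∎

  sgn-period : ∀ m → sgn R (4 N.+ m) ≈ sgn R m
  sgn-period m = trans (-‿involutive _) (-‿involutive _)

  value-plus : ∀ a b y p₂ p₃ p₄ q →
    expansionValue a b y p₂ p₃ p₄ q 1# ≈ y + a * p₃ - a * p₂ + (a * (q + a) - b * p₄)
  value-plus a b y p₂ p₃ p₄ q =
    +-cong (sub₂ (+-congˡ (*-identityˡ _)) (*-identityˡ _))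
           (+-cong (trans (*-identityˡ _) (*-congˡ (+-congˡ (*-identityˡ a)))) (-1*x≈-x _))

  value-minus : ∀ a b y p₂ p₃ p₄ q →
    expansionValue a b y p₂ p₃ p₄ q (- 1#) ≈ y - a * p₃ + a * p₂ + (a * (a - q) + b * p₄)
  value-minus a b y p₂ p₃ p₄ q =
    +-cong (+-cong (+-congˡ (-1*x≈-x _)) (trans (-‿cong (-1*x≈-x _)) (-‿involutive _)))
           (+-cong a-term (trans (*-congʳ (-‿involutive 1#)) (*-identityˡ _)))
    where
    a-term : - 1# * (a * (q + - 1# * a)) ≈ a * (a - q)
    a-term = begin
      - 1# * (a * (q + - 1# * a)) ≈⟨ -1*x≈-x _ ⟩
      - (a * (q + - 1# * a))      ≈⟨ -‿cong (*-congˡ (+-congˡ (-1*x≈-x a))) ⟩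
      - (a * (q - a))             ≈⟨ -‿distribʳ-* a _ ⟩
      a * - (q - a)               ≈⟨ *-congˡ (⁻¹-anti-homo‿- q a) ⟩
      a * (a - q)                 ∎

  -- The right-hand side of the theorem for each residue of n modulo 4
  -- (arguments beyond 3 do not occur).
  residueValue : Carrier → Carrier → ℕ → Carrier
  residueValue a b 0 = (a - 1#) * (a - 1#)
  residueValue a b 1 = a * a + b + 1#
  residueValue a b 2 = a * a + (a + a) - b
  residueValue a b (suc (suc (suc _))) = a * a

  expansionAt₀ : ∀ a b → expansionAt a b 0 ≈ residueValue a b 1
  expansionAt₀ a b = begin
    expansionAt a b 0
      ≈⟨ expansionValue-cong a b (trans (D₀-period 1) D₀₁) P₂ P₃ (trans (P-period 0) P₀) Q₃
                                 (-‿cong (-‿involutive 1#)) ⟩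
    expansionValue a b 1# 0# 0# 1# 0# (- 1#)
      ≈⟨ value-minus a b 1# 0# 0# 1# 0# ⟩
    1# - a * 0# + a * 0# + (a * (a - 0#) + b * 1#)
      ≈⟨ +-cong (x-y+y≈x 1# _) (+-cong (*-congˡ (x-0≈x a)) (*-identityʳ b)) ⟩
    1# + (a * a + b)
      ≈⟨ +-comm _ _ ⟩
    a * a + b + 1# ∎

  expansionAt₁ : ∀ a b → expansionAt a b 1 ≈ residueValue a b 2
  expansionAt₁ a b = begin
    expansionAt a b 1
      ≈⟨ expansionValue-cong a b (trans (D₀-period 2) D₀₂) P₃ (trans (P-period 0) P₀)
                                 (trans (P-period 1) P₁) (trans (Q-period 0) Q₀)
                                 (sgn-period 0) ⟩
    expansionValue a b 0# 0# 1# 1# 1# 1#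
      ≈⟨ value-plus a b 0# 0# 1# 1# 1# ⟩
    0# + a * 1# - a * 0# + (a * (1# + a) - b * 1#)
      ≈⟨ +-cong (trans (+-congʳ (trans (+-identityˡ _) (*-identityʳ a)))
                       (trans (+-congˡ (-‿cong (zeroʳ a))) (x-0≈x a)))
                (+-cong (trans (distribˡ a 1# a) (+-congʳ (*-identityʳ a))) (-‿cong (*-identityʳ b))) ⟩
    a + (a + a * a - b)
      ≈⟨ sym (+-assoc _ _ _) ⟩
    a + (a + a * a) - b
      ≈⟨ +-congʳ (trans (sym (+-assoc _ _ _)) (+-comm _ _)) ⟩
    a * a + (a + a) - b ∎

  expansionAt₂ : ∀ a b → expansionAt a b 2 ≈ residueValue a b 3
  expansionAt₂ a b = begin
    expansionAt a b 2
      ≈⟨ expansionValue-cong a b (trans (D₀-period 3) D₀₃) (trans (P-period 0) P₀)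
                                 (trans (P-period 1) P₁) (trans (P-period 2) P₂)
                                 (trans (Q-period 1) Q₁) (-‿cong (sgn-period 0)) ⟩
    expansionValue a b 0# 1# 1# 0# 0# (- 1#)
      ≈⟨ value-minus a b 0# 1# 1# 0# 0# ⟩
    0# - a * 1# + a * 1# + (a * (a - 0#) + b * 0#)
      ≈⟨ +-cong (x-y+y≈x 0# _) (+-cong (*-congˡ (x-0≈x a)) (zeroʳ b)) ⟩
    0# + (a * a + 0#)
      ≈⟨ trans (+-identityˡ _) (+-identityʳ _) ⟩
    a * a ∎

  expansionAt₃ : ∀ a b → expansionAt a b 3 ≈ residueValue a b 0
  expansionAt₃ a b = begin
    expansionAt a b 3
      ≈⟨ expansionValue-cong a b (trans (D₀-period 4) (trans (D₀-period 0) D₀₀))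
                                 (trans (P-period 1) P₁) (trans (P-period 2) P₂)
                                 (trans (P-period 3) P₃) (trans (Q-period 2) Q₂)
                                 (trans (-‿involutive _) (sgn-period 0)) ⟩
    expansionValue a b 1# 1# 0# 0# (- 1#) 1#
      ≈⟨ value-plus a b 1# 1# 0# 0# (- 1#) ⟩
    1# + a * 0# - a * 1# + (a * (- 1# + a) - b * 0#)
      ≈⟨ +-cong (sub₂ (trans (+-congˡ (zeroʳ a)) (+-identityʳ 1#)) (*-identityʳ a))
                (trans (+-cong (trans (distribˡ a (- 1#) a) (+-congʳ a·-1≈-a)) (trans (-‿cong (zeroʳ b)) -0#≈0#))
                       (+-identityʳ _)) ⟩
    (1# - a) + (- a + a * a)
      ≈⟨ trans (+-comm _ _) (+-cong (+-comm _ _) (+-comm _ _)) ⟩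
    (a * a - a) + (- a + 1#)
      ≈⟨ sym square ⟩
    (a - 1#) * (a - 1#) ∎
    where
    a·-1≈-a : a * - 1# ≈ - a
    a·-1≈-a = trans (*-comm a (- 1#)) (-1*x≈-x a)
    square : (a - 1#) * (a - 1#) ≈ (a * a - a) + (- a + 1#)
    square = begin
      (a - 1#) * (a - 1#)                     ≈⟨ distribʳ (a - 1#) a (- 1#) ⟩
      a * (a - 1#) + - 1# * (a - 1#)          ≈⟨ +-cong (distribˡ a a (- 1#)) (-1*x≈-x _) ⟩
      (a * a + a * - 1#) + - (a - 1#)         ≈⟨ +-cong (+-congˡ a·-1≈-a) (⁻¹-anti-homo‿- a 1#) ⟩
      (a * a - a) + (1# - a)                  ≈⟨ +-congˡ (+-comm 1# (- a)) ⟩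
      (a * a - a) + (- a + 1#)                ∎

  expansionAt-period : ∀ a b k → expansionAt a b (4 N.+ k) ≈ expansionAt a b k
  expansionAt-period a b k =
    expansionValue-cong a b (D₀-period (5 N.+ k))
      (P-period (2 N.+ k)) (P-period (3 N.+ k))
      (P-period (4 N.+ k)) (Q-period (3 N.+ k)) (sgn-period (3 N.+ k))

  expansionAt-residue : ∀ a b k → expansionAt a b k ≈ residueValue a b ((5 N.+ k) % 4)
  expansionAt-residue a b 0 = expansionAt₀ a b
  expansionAt-residue a b 1 = expansionAt₁ a b
  expansionAt-residue a b 2 = expansionAt₂ a b
  expansionAt-residue a b 3 = expansionAt₃ a b
  expansionAt-residue a b (suc (suc (suc (suc k)))) =
    trans (expansionAt-period a b k)
          (trans (expansionAt-residue a b k) (reflexive (P.cong (residueValue a b) (P.sym residue))))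
    where
    residue : (9 N.+ k) % 4 ≡ (5 N.+ k) % 4
    residue = P.trans (P.cong (_% 4) (NP.+-comm 4 (5 N.+ k))) ([m+n]%n≡m%n (5 N.+ k) 4)

  det-Bmat : ∀ a b k → det R (5 N.+ k) (Bmat R (5 N.+ k) a b) ≈ residueValue a b ((5 N.+ k) % 4)
  det-Bmat a b k = trans (Expansion.B-formula a b k) (expansionAt-residue a b k)

theorem3 : ∀ {c ℓ : Level} (R : CommutativeRing c ℓ) →
    let open CommutativeRing R in
    (a b : Carrier) (n : ℕ) → 5 ≤ n →
      (n % 4 ≡ 0 → det R n (Bmat R n a b) ≈ (a - 1#) * (a - 1#))
      × (n % 4 ≡ 1 → det R n (Bmat R n a b) ≈ a * a + b + 1#)
      × (n % 4 ≡ 2 → det R n (Bmat R n a b) ≈ a * a + (a + a) - b)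
      × (n % 4 ≡ 3 → det R n (Bmat R n a b) ≈ a * a)
-- Write n = 5 + (n - 5) and read off the residue of n modulo 4.
theorem3 R a b n 5≤n = at 0 , at 1 , at 2 , at 3
  where
  open CommutativeRing R using (_≈_)
  Bₙ : det R n (Bmat R n a b) ≈ residueValue R a b (n % 4)
  Bₙ = P.subst (λ m → det R m (Bmat R m a b) ≈ residueValue R a b (m % 4))
               (NP.m+[n∸m]≡n 5≤n) (det-Bmat R a b (n ∸ 5))
  at : ∀ r → n % 4 ≡ r → det R n (Bmat R n a b) ≈ residueValue R a b r
  at r n%4≡r = P.subst (λ v → det R n (Bmat R n a b) ≈ residueValue R a b v) n%4≡r Bₙ
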